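{- For every integer $n\ge 0$, there is a bijection between the set of isomorphism classes of $XY$-graphs on $n$ vertices with no isolates in $Y$ and the set of isomorphism classes of bipartite posets on $n$ elements which maps unbalanced $XY$-graphs to unbalanced bipartite posets and balanced $XY$-graphs to balanced bipartite posets.
   Context: An $XY$-graph is a bipartite graph with a specified ordered bipartition $X\cup Y$ of its vertices (edges join $X$ to $Y$); isomorphisms must map $X$ onto $X'$ and $Y$ onto $Y'$. A vertex of $Y$ is an isolate if it has no neighbor; a vertex of $X$ is universal if it is adjacent to every vertex of $Y$. An $XY$-graph with no isolates in $Y$ is unbalanced if $X$ has a universal vertex and balanced otherwise. A bipartite poset is a finite poset of height at most one (no $x\prec y\prec z$). An element $v$ has height 1 if some $u\prec v$, height 0 otherwise; a height-0 element is a full support point if it is comparable to every height-1 element. A bipartite poset is unbalanced if it has a full support point and balanced otherwise. Posets are considered up to isomorphism. -}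

module Defs where

open import Data.Nat using (ℕ; _+_)
open import Data.Fin using (Fin)
open import Data.Bool using (Bool; true; false; _∧_)
open import Data.Product using (Σ; ∃; _×_; _,_)
open import Data.Sum using (_⊎_)
open import Relation.Nullary using (¬_)
open import Relation.Binary.PropositionalEquality using (_≡_; _≢_)
open import Function.Bundles using (_↔_; Inverse)

record XYGraph (n : ℕ) : Set where
  field
    nx   : ℕ
    ny   : ℕ
    size : nx + ny ≡ n
    adj  : Fin nx → Fin ny → Bool

open XYGraph public

NoIsolates : ∀ {n} → XYGraph n → Set
NoIsolates G = (y : Fin (ny G)) → ∃ λ (x : Fin (nx G)) → adj G x y ≡ true

XYGraphNI : ℕ → Set
XYGraphNI n = Σ (XYGraph n) NoIsolates

_≅G_ : ∀ {n} → XYGraph n → XYGraph n → Set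
G ≅G H = Σ (Fin (nx G) ↔ Fin (nx H)) λ σ → Σ (Fin (ny G) ↔ Fin (ny H)) λ τ →
  ∀ x y → adj G x y ≡ adj H (Inverse.to σ x) (Inverse.to τ y)

_≅GNI_ : ∀ {n} → XYGraphNI n → XYGraphNI n → Set
(G , _) ≅GNI (H , _) = G ≅G H

Universal : ∀ {n} (G : XYGraph n) → Fin (nx G) → Set
Universal G x = (y : Fin (ny G)) → adj G x y ≡ true

UnbalancedG : ∀ {n} → XYGraphNI n → Set
UnbalancedG (G , _) = ∃ λ x → Universal G x

BalancedG : ∀ {n} → XYGraphNI n → Set
BalancedG G = ¬ UnbalancedG G

record BipPoset (n : ℕ) : Set where
  field
    le      : Fin n → Fin n → Bool
    refl    : ∀ x → le x x ≡ true
    antisym : ∀ x y → le x y ≡ true → le y x ≡ true → x ≡ y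
    trans   : ∀ x y z → le x y ≡ true → le y z ≡ true → le x z ≡ true

  _≺_ : Fin n → Fin n → Set
  x ≺ y = (le x y ≡ true) × (x ≢ y)

  field
    height≤1 : ∀ x y z → x ≺ y → ¬ (y ≺ z)

open BipPoset public

_≅P_ : ∀ {n} → BipPoset n → BipPoset n → Set
_≅P_ {n} P Q = Σ (Fin n ↔ Fin n) λ σ →
  ∀ x y → le P x y ≡ le Q (Inverse.to σ x) (Inverse.to σ y)

module _ {n : ℕ} (P : BipPoset n) where
  Height1 : Fin n → Set
  Height1 v = ∃ λ u → _≺_ P u v

  Height0 : Fin n → Set
  Height0 v = ¬ Height1 v

  Comparable : Fin n → Fin n → Set
  Comparable u v = (le P u v ≡ true) ⊎ (le P v u ≡ true)

  FullSupportPoint : Fin n → Set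
  FullSupportPoint v = Height0 v × (∀ w → Height1 w → Comparable v w)

  UnbalancedP : Set
  UnbalancedP = ∃ λ v → FullSupportPoint v

  BalancedP : Set
  BalancedP = ¬ UnbalancedP

-- The correspondence sends G to the poset on X ⊎ Y (numbered by Fin n) whose strict
-- relations are exactly x ≺ y for the edges xy of G.  Everything rests on one
-- observation: since Y has no isolates, the height-1 elements of this poset are
-- exactly the vertices of Y, and the height-0 elements exactly those of X.  Hence
--   * a graph isomorphism X⊎Y ↔ X'⊎Y' is an order isomorphism;
--   * an order isomorphism preserves height, so it maps X onto X' and Y onto Y'
--     and restricts to a graph isomorphism;
--   * every bipartite poset arises, from the graph whose X is its height-0 part and
--     whose Y is its height-1 part;
--   * full support points are exactly the universal vertices of X.
module Submission where

open import Defs hiding (refl; trans; antisym)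
open import Data.Nat using (ℕ; zero; suc)
open import Data.Bool using (Bool; true; false; not)
open import Data.Bool.Properties using (¬-not; not-involutive) renaming (_≟_ to _≟ᴮ_)
open import Data.Empty using (⊥; ⊥-elim)
open import Data.Fin using (Fin; zero; suc; _≟_)
open import Data.Fin.Properties using (+↔⊎; any?)
open import Data.Fin.Permutation using (↔⇒≡)
open import Data.Product using (Σ; ∃; _×_; _,_; proj₁; proj₂)
open import Data.Sum using (_⊎_; inj₁; inj₂; swap) renaming (map to ⊎-map)
open import Data.Sum.Properties using (inj₁-injective; inj₂-injective; swap-↔; swap-involutive)
open import Data.Sum.Function.Propositional using (_⊎-↔_)
open import Data.Unit using (⊤; tt)
open import Function.Bundles using (_↔_; _⇔_; Inverse; Injection; Equivalence; mk↔ₛ′; mk⇔)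
open import Function.Properties.Inverse using (↔-refl; ↔-sym; ↔-trans; ↔⇒↣)
open import Function.Properties.Equivalence using () renaming (trans to ⇔-trans; sym to ⇔-sym)
open import Function.Related.TypeIsomorphisms using (⊎-assoc)
open import Level using (0ℓ)
open import Relation.Nullary using (¬_; Dec; yes; no; does)
open import Relation.Nullary.Decidable using (dec-true; does-⇔; ¬?; _×-dec_)
open import Relation.Unary using (Decidable)
open import Relation.Binary.PropositionalEquality
  using (_≡_; _≢_; refl; sym; trans; cong; cong₂; subst; subst₂; module ≡-Reasoning)

open Inverse using (to; from; strictlyInverseˡ; strictlyInverseʳ)

private
  variable
    A B C D : Set
    k m n : ℕ

to-injective : (e : A ↔ B) {a a' : A} → to e a ≡ to e a' → a ≡ a'
to-injective e = Injection.injective (↔⇒↣ e)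

does-sound : (d : Dec A) → does d ≡ true → A
does-sound (yes a) _ = a

≡false-ext : {a b : Bool} → (a ≡ false ⇔ b ≡ false) → a ≡ b
≡false-ext {true}  {true}  _ = refl
≡false-ext {false} {false} _ = refl
≡false-ext {true}  {false} a⇔b = Equivalence.from a⇔b refl
≡false-ext {false} {true}  a⇔b = sym (Equivalence.to a⇔b refl)

isLeft : A ⊎ B → Bool
isLeft (inj₁ _) = true
isLeft (inj₂ _) = false

isLeft-swap : (s : A ⊎ B) → isLeft (swap s) ≡ not (isLeft s)
isLeft-swap (inj₁ _) = refl
isLeft-swap (inj₂ _) = refl

fromLeft : (s : A ⊎ B) → isLeft s ≡ true → A
fromLeft (inj₁ a) _ = a

fromLeft-inj₁ : (s : A ⊎ B) (p : isLeft s ≡ true) → inj₁ (fromLeft s p) ≡ s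
fromLeft-inj₁ (inj₁ a) _ = refl

inj₁≢inj₂ : {a : A} {b : B} → inj₁ a ≢ inj₂ b
inj₁≢inj₂ ()

SidePreserving : (A ⊎ B) ↔ (C ⊎ D) → Set
SidePreserving ρ = ∀ s → isLeft (to ρ s) ≡ isLeft s

restrictˡ : {A B C D : Set} (ρ : (A ⊎ B) ↔ (C ⊎ D)) → SidePreserving ρ →
  Σ (A ↔ C) λ σ → ∀ a → to ρ (inj₁ a) ≡ inj₁ (to σ a)
restrictˡ {A} {C = C} ρ pres = σ , λ a → sym (fromLeft-inj₁ _ (pres (inj₁ a)))
  where
  pres⁻¹ : SidePreserving (↔-sym ρ)
  pres⁻¹ t = trans (sym (pres (from ρ t))) (cong isLeft (strictlyInverseˡ ρ t))

  σ→ : A → C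
  σ→ a = fromLeft (to ρ (inj₁ a)) (pres (inj₁ a))

  σ← : C → A
  σ← c = fromLeft (from ρ (inj₁ c)) (pres⁻¹ (inj₁ c))

  σ→σ← : ∀ c → σ→ (σ← c) ≡ c
  σ→σ← c = inj₁-injective (begin
    inj₁ (σ→ (σ← c))        ≡⟨ fromLeft-inj₁ _ _ ⟩
    to ρ (inj₁ (σ← c))      ≡⟨ cong (to ρ) (fromLeft-inj₁ _ _) ⟩
    to ρ (from ρ (inj₁ c))  ≡⟨ strictlyInverseˡ ρ _ ⟩
    inj₁ c                  ∎)
    where open ≡-Reasoning

  σ←σ→ : ∀ a → σ← (σ→ a) ≡ a
  σ←σ→ a = inj₁-injective (begin
    inj₁ (σ← (σ→ a))        ≡⟨ fromLeft-inj₁ _ _ ⟩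
    from ρ (inj₁ (σ→ a))    ≡⟨ cong (from ρ) (fromLeft-inj₁ _ _) ⟩
    from ρ (to ρ (inj₁ a))  ≡⟨ strictlyInverseʳ ρ _ ⟩
    inj₁ a                  ∎)
    where open ≡-Reasoning

  σ : A ↔ C
  σ = mk↔ₛ′ σ→ σ← σ→σ← σ←σ→

-- A side-preserving bijection of sums is a sum of bijections (the right summands
-- are handled by restricting the bijection conjugated by swap).
restrict : {A B C D : Set} (ρ : (A ⊎ B) ↔ (C ⊎ D)) → SidePreserving ρ →
  Σ (A ↔ C) λ σ → Σ (B ↔ D) λ τ →
    (∀ a → to ρ (inj₁ a) ≡ inj₁ (to σ a)) × (∀ b → to ρ (inj₂ b) ≡ inj₂ (to τ b))
restrict {A} {B} {C} {D} ρ pres with restrictˡ ρ pres | restrictˡ ρˢ presˢ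
  where
  ρˢ : (B ⊎ A) ↔ (D ⊎ C)
  ρˢ = ↔-trans swap-↔ (↔-trans ρ swap-↔)
  presˢ : SidePreserving ρˢ
  presˢ s = begin
    isLeft (swap (to ρ (swap s)))  ≡⟨ isLeft-swap (to ρ (swap s)) ⟩
    not (isLeft (to ρ (swap s)))   ≡⟨ cong not (pres (swap s)) ⟩
    not (isLeft (swap s))          ≡⟨ cong not (isLeft-swap s) ⟩
    not (not (isLeft s))           ≡⟨ not-involutive (isLeft s) ⟩
    isLeft s                       ∎
    where open ≡-Reasoning
... | σ , ρ-inj₁ | τ , ρˢ-inj₁ =
  σ , τ , ρ-inj₁ , λ b → trans (sym (swap-involutive _)) (cong swap (ρˢ-inj₁ b))

Fin-suc↔ : Fin (suc k) ↔ (⊤ ⊎ Fin k)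
Fin-suc↔ = mk↔ₛ′ (λ { zero → inj₁ tt ; (suc i) → inj₂ i })
                 (λ { (inj₁ _) → zero ; (inj₂ i) → suc i })
                 (λ { (inj₁ _) → refl ; (inj₂ _) → refl })
                 (λ { zero → refl ; (suc _) → refl })

consˡ : (Fin k ⊎ Fin m) ↔ Fin n → (Fin (suc k) ⊎ Fin m) ↔ Fin (suc n)
consˡ e = ↔-trans (Fin-suc↔ ⊎-↔ ↔-refl)
         (↔-trans (⊎-assoc 0ℓ _ _ _)
         (↔-trans (↔-refl ⊎-↔ e) (↔-sym Fin-suc↔)))

consʳ : (Fin k ⊎ Fin m) ↔ Fin n → (Fin k ⊎ Fin (suc m)) ↔ Fin (suc n)
consʳ e = ↔-trans swap-↔ (consˡ (↔-trans swap-↔ e))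

record Split {n : ℕ} (P : Fin n → Set) : Set where
  field
    {nFail nHold} : ℕ
    enum          : (Fin nFail ⊎ Fin nHold) ↔ Fin n
    left-fails    : ∀ x → ¬ P (to enum (inj₁ x))
    right-holds   : ∀ y → P (to enum (inj₂ y))

split : {P : Fin n → Set} → Decidable P → Split P
split {zero} P? = record
  { enum = ↔-sym (+↔⊎ {0} {0}) ; left-fails = λ () ; right-holds = λ () }
split {suc n} {P} P? with P? zero | split {P = λ i → P (suc i)} (λ i → P? (suc i))
... | no ¬P0 | record { enum = e ; left-fails = l ; right-holds = r } = record
  { enum = consˡ e
  ; left-fails = λ { zero → ¬P0 ; (suc x) → l x }
  ; right-holds = r }
... | yes P0 | record { enum = e ; left-fails = l ; right-holds = r } = record
  { enum = consʳ e
  ; left-fails = l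
  ; right-holds = λ { zero → P0 ; (suc y) → r y } }

module _ (Q : BipPoset n) where

  height1? : ∀ v → Dec (Height1 Q v)
  height1? v = any? (λ u → (le Q u v ≟ᴮ true) ×-dec ¬? (u ≟ v))

  height1-maximal : ∀ {u v} → Height1 Q u → le Q u v ≡ true → u ≡ v
  height1-maximal {u} {v} (w , w≺u) u≤v with u ≟ v
  ... | yes u≡v = u≡v
  ... | no u≢v = ⊥-elim (height≤1 Q w u v w≺u (u≤v , u≢v))

  height0-minimal : ∀ {u v} → Height0 Q v → le Q u v ≡ true → u ≡ v
  height0-minimal {u} {v} h0 u≤v with u ≟ v
  ... | yes u≡v = u≡v
  ... | no u≢v = ⊥-elim (h0 (u , u≤v , u≢v))

≅P-height1 : {P Q : BipPoset n} ((π , _) : P ≅P Q) →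
  ∀ v → Height1 P v ⇔ Height1 Q (to π v)
≅P-height1 {P = P} {Q} (π , pres) v = mk⇔ forth back
  where
  forth : Height1 P v → Height1 Q (to π v)
  forth (u , u≤v , u≢v) =
    to π u , trans (sym (pres u v)) u≤v , λ eq → u≢v (to-injective π eq)
  back : Height1 Q (to π v) → Height1 P v
  back (w , w≤πv , w≢πv) = from π w , u≤v , λ eq → w≢πv (trans w≡πu (cong (to π) eq))
    where
    w≡πu : w ≡ to π (from π w)
    w≡πu = sym (strictlyInverseˡ π w)
    u≤v : le P (from π w) v ≡ true
    u≤v = trans (pres (from π w) v) (subst (λ z → le Q z (to π v) ≡ true) w≡πu w≤πv)

_⊑[_]_ : Fin k ⊎ Fin m → (Fin k → Fin m → Bool) → Fin k ⊎ Fin m → Bool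
inj₁ x ⊑[ E ] inj₁ x' = does (x ≟ x')
inj₁ x ⊑[ E ] inj₂ y  = E x y
inj₂ y ⊑[ E ] inj₁ x  = false
inj₂ y ⊑[ E ] inj₂ y' = does (y ≟ y')

module SumOrder {k m : ℕ} (E : Fin k → Fin m → Bool) where

  _⊑_ : Fin k ⊎ Fin m → Fin k ⊎ Fin m → Bool
  s ⊑ t = s ⊑[ E ] t

  ⊑-refl : ∀ s → s ⊑ s ≡ true
  ⊑-refl (inj₁ x) = dec-true (x ≟ x) refl
  ⊑-refl (inj₂ y) = dec-true (y ≟ y) refl

  ⊑-antisym : ∀ s t → s ⊑ t ≡ true → t ⊑ s ≡ true → s ≡ t
  ⊑-antisym (inj₁ x) (inj₁ x') s⊑t _ = cong inj₁ (does-sound (x ≟ x') s⊑t)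
  ⊑-antisym (inj₂ y) (inj₂ y') s⊑t _ = cong inj₂ (does-sound (y ≟ y') s⊑t)

  ⊑-trans : ∀ s t u → s ⊑ t ≡ true → t ⊑ u ≡ true → s ⊑ u ≡ true
  ⊑-trans (inj₁ x) (inj₁ x') u s⊑t t⊑u with refl ← does-sound (x ≟ x') s⊑t = t⊑u
  ⊑-trans (inj₂ y) (inj₂ y') u s⊑t t⊑u with refl ← does-sound (y ≟ y') s⊑t = t⊑u
  ⊑-trans (inj₁ x) (inj₂ y) (inj₂ y') s⊑t t⊑u with refl ← does-sound (y ≟ y') t⊑u = s⊑t

  ⊑-strict : ∀ s t → s ⊑ t ≡ true → s ≢ t → isLeft s ≡ true × isLeft t ≡ false
  ⊑-strict (inj₁ x) (inj₁ x') s⊑t s≢t = ⊥-elim (s≢t (cong inj₁ (does-sound (x ≟ x') s⊑t)))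
  ⊑-strict (inj₁ x) (inj₂ y)  _   _   = refl , refl
  ⊑-strict (inj₂ y) (inj₂ y') s⊑t s≢t = ⊥-elim (s≢t (cong inj₂ (does-sound (y ≟ y') s⊑t)))

  -- Hence ⊑ has height at most one: in a chain s ≺ t ≺ u, t would lie on both sides.
  ⊑-height≤1 : ∀ s t u → s ⊑ t ≡ true → s ≢ t → t ⊑ u ≡ true → t ≢ u → ⊥
  ⊑-height≤1 s t u s⊑t s≢t t⊑u t≢u
    with trans (sym (proj₁ (⊑-strict t u t⊑u t≢u))) (proj₂ (⊑-strict s t s⊑t s≢t))
  ... | ()

  universal-below : ∀ {x} → (∀ y → E x y ≡ true) → ∀ t → isLeft t ≡ false → inj₁ x ⊑ t ≡ true
  universal-below univ (inj₂ y) _ = univ y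

  comparable-edge : ∀ {x y} → (inj₁ x ⊑ inj₂ y ≡ true) ⊎ (inj₂ y ⊑ inj₁ x ≡ true) → E x y ≡ true
  comparable-edge (inj₁ Exy) = Exy

⊑-map : ∀ {k m k' m'} {E : Fin k → Fin m → Bool} {E' : Fin k' → Fin m' → Bool}
  (σ : Fin k ↔ Fin k') (τ : Fin m ↔ Fin m') → (∀ x y → E x y ≡ E' (to σ x) (to τ y)) →
  ∀ s t → s ⊑[ E ] t ≡ ⊎-map (to σ) (to τ) s ⊑[ E' ] ⊎-map (to σ) (to τ) t
⊑-map σ τ pres (inj₁ x) (inj₁ x') =
  does-⇔ (mk⇔ (cong (to σ)) (to-injective σ)) (x ≟ x') (to σ x ≟ to σ x')
⊑-map σ τ pres (inj₁ x) (inj₂ y)  = pres x y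
⊑-map σ τ pres (inj₂ y) (inj₁ x)  = refl
⊑-map σ τ pres (inj₂ y) (inj₂ y') =
  does-⇔ (mk⇔ (cong (to τ)) (to-injective τ)) (y ≟ y') (to τ y ≟ to τ y')

module SumPoset {k m n : ℕ} (E : Fin k → Fin m → Bool) (e : (Fin k ⊎ Fin m) ↔ Fin n) where
  open SumOrder E public

  pos : Fin n → Fin k ⊎ Fin m
  pos = from e

  pos-to : ∀ s → pos (to e s) ≡ s
  pos-to = strictlyInverseʳ e

  pos-injective : ∀ {u v} → pos u ≡ pos v → u ≡ v
  pos-injective = to-injective (↔-sym e)

  poset : BipPoset n
  poset = record
    { le       = λ u v → pos u ⊑ pos v
    ; refl     = λ u → ⊑-refl (pos u)
    ; antisym  = λ u v u≤v v≤u → pos-injective (⊑-antisym (pos u) (pos v) u≤v v≤u)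
    ; trans    = λ u v w → ⊑-trans (pos u) (pos v) (pos w)
    ; height≤1 = λ u v w (u≤v , u≢v) (v≤w , v≢w) →
        ⊑-height≤1 (pos u) (pos v) (pos w) u≤v (λ eq → u≢v (pos-injective eq))
                                           v≤w (λ eq → v≢w (pos-injective eq)) }

  le-to : ∀ s t → le poset (to e s) (to e t) ≡ s ⊑ t
  le-to s t = cong₂ _⊑_ (pos-to s) (pos-to t)

  height1-right : ∀ {v} → Height1 poset v → isLeft (pos v) ≡ false
  height1-right {v} (u , u≤v , u≢v) =
    proj₂ (⊑-strict (pos u) (pos v) u≤v (λ eq → u≢v (pos-injective eq)))

  left-height0 : ∀ x → Height0 poset (to e (inj₁ x))
  left-height0 x h1 with trans (sym (cong isLeft (pos-to (inj₁ x)))) (height1-right h1)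
  ... | ()

  module _ (noIsolates : ∀ y → ∃ λ x → E x y ≡ true) where

    right-height1 : ∀ y → Height1 poset (to e (inj₂ y))
    right-height1 y with x , Exy ← noIsolates y =
      to e (inj₁ x) , trans (le-to (inj₁ x) (inj₂ y)) Exy , λ eq → inj₁≢inj₂ (to-injective e eq)

    height1⇔right : ∀ v → Height1 poset v ⇔ isLeft (pos v) ≡ false
    height1⇔right v = mk⇔ height1-right (right⇒height1 (pos v) (strictlyInverseˡ e v))
      where
      right⇒height1 : ∀ s → to e s ≡ v → isLeft s ≡ false → Height1 poset v
      right⇒height1 (inj₂ y) eq _ = subst (Height1 poset) eq (right-height1 y)

enumG : (G : XYGraph n) → (Fin (nx G) ⊎ Fin (ny G)) ↔ Fin n
enumG G = subst (λ n → (Fin (nx G) ⊎ Fin (ny G)) ↔ Fin n) (size G) (↔-sym +↔⊎)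

module GraphPoset {n : ℕ} (G : XYGraph n) = SumPoset (adj G) (enumG G)

graphPoset : XYGraphNI n → BipPoset n
graphPoset (G , _) = GraphPoset.poset G

graphPoset-cong : {n : ℕ} (G H : XYGraphNI n) → G ≅GNI H → graphPoset G ≅P graphPoset H
graphPoset-cong {n} (G , _) (H , _) (σ , τ , pres) = π , preserves
  where
  module G = GraphPoset G
  module H = GraphPoset H
  π : Fin n ↔ Fin n
  π = ↔-trans (↔-sym (enumG G)) (↔-trans (σ ⊎-↔ τ) (enumG H))
  preserves : ∀ u v → le G.poset u v ≡ le H.poset (to π u) (to π v)
  preserves u v = begin
    G.pos u G.⊑ G.pos v                                          ≡⟨ ⊑-map σ τ pres (G.pos u) (G.pos v) ⟩
    ⊎-map (to σ) (to τ) (G.pos u) H.⊑ ⊎-map (to σ) (to τ) (G.pos v) ≡⟨ sym (H.le-to _ _) ⟩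
    le H.poset (to π u) (to π v)                                 ∎
    where open ≡-Reasoning

sumIso⇒graphIso : (G H : XYGraph n) (ρ : (Fin (nx G) ⊎ Fin (ny G)) ↔ (Fin (nx H) ⊎ Fin (ny H))) →
  SidePreserving ρ → (∀ s t → s ⊑[ adj G ] t ≡ to ρ s ⊑[ adj H ] to ρ t) → G ≅G H
sumIso⇒graphIso G H ρ sides pres with restrict ρ sides
... | σ , τ , ρ-inj₁ , ρ-inj₂ = σ , τ , λ x y →
  trans (pres (inj₁ x) (inj₂ y)) (cong₂ (λ s t → s ⊑[ adj H ] t) (ρ-inj₁ x) (ρ-inj₂ y))

-- Order isomorphisms preserve height, hence sides, hence come from graph isomorphisms.
graphPoset-reflects : {n : ℕ} (G H : XYGraphNI n) → graphPoset G ≅P graphPoset H → G ≅GNI H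
graphPoset-reflects (G , noIsoG) (H , noIsoH) (π , pres) = sumIso⇒graphIso G H ρ sides ⊑-preserved
  where
  module G = GraphPoset G
  module H = GraphPoset H
  ρ : (Fin (nx G) ⊎ Fin (ny G)) ↔ (Fin (nx H) ⊎ Fin (ny H))
  ρ = ↔-trans (enumG G) (↔-trans π (↔-sym (enumG H)))

  sides : SidePreserving ρ
  sides s = trans (≡false-ext sameHeight) (cong isLeft (G.pos-to s))
    where
    sameHeight : isLeft (to ρ s) ≡ false ⇔ isLeft (G.pos (to (enumG G) s)) ≡ false
    sameHeight = ⇔-trans (⇔-sym (H.height1⇔right noIsoH _))
                 (⇔-trans (⇔-sym (≅P-height1 {P = G.poset} {H.poset} (π , pres) (to (enumG G) s)))
                          (G.height1⇔right noIsoG _))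

  ⊑-preserved : ∀ s t → s G.⊑ t ≡ to ρ s H.⊑ to ρ t
  ⊑-preserved s t = trans (sym (G.le-to s t)) (pres _ _)

module _ {n : ℕ} (G : XYGraph n) where
  open GraphPoset G

  universal⇒fullSupport : ∀ {x} → Universal G x → FullSupportPoint poset (to (enumG G) (inj₁ x))
  universal⇒fullSupport {x} univ = left-height0 x , λ w h1 →
    inj₁ (subst (λ s → s ⊑ pos w ≡ true) (sym (pos-to (inj₁ x)))
                (universal-below univ (pos w) (height1-right h1)))

  fullSupport⇒universal : NoIsolates G → ∀ {v} → FullSupportPoint poset v → ∃ λ x → Universal G x
  fullSupport⇒universal noIso {v} (h0 , comparable) = positioned (pos v) refl
    where
    positioned : ∀ s → pos v ≡ s → ∃ λ x → Universal G x
    positioned (inj₂ _) eq = ⊥-elim (h0 (Equivalence.from (height1⇔right noIso v) (cong isLeft eq)))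
    positioned (inj₁ x) eq = x , λ y → comparable-edge
      (subst₂ (λ s t → (s ⊑ t ≡ true) ⊎ (t ⊑ s ≡ true)) eq (pos-to (inj₂ y))
              (comparable (to (enumG G) (inj₂ y)) (right-height1 noIso y)))

graphPoset-unbalanced : (G : XYGraphNI n) → UnbalancedG G → UnbalancedP (graphPoset G)
graphPoset-unbalanced (G , _) (x , univ) = to (enumG G) (inj₁ x) , universal⇒fullSupport G univ

graphPoset-balanced : (G : XYGraphNI n) → BalancedG G → BalancedP (graphPoset G)
graphPoset-balanced (G , noIso) balanced (_ , fullSupport) =
  balanced (fullSupport⇒universal G noIso fullSupport)

module PosetGraph {n : ℕ} (Q : BipPoset n) where
  open Split (split (height1? Q)) public

  graph : XYGraph n
  graph = record
    { nx   = nFail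
    ; ny   = nHold
    ; size = ↔⇒≡ (↔-trans +↔⊎ enum)
    ; adj  = λ x y → le Q (to enum (inj₁ x)) (to enum (inj₂ y)) }

  -- Whatever lies strictly below an element of Y has height 0, so lies in X.
  noIsolates : NoIsolates graph
  noIsolates y with u , u≤v , u≢v ← right-holds y =
    below (from enum u) (strictlyInverseˡ enum u) u≤v u≢v
    where
    v : Fin n
    v = to enum (inj₂ y)
    below : ∀ {u} s → to enum s ≡ u → le Q u v ≡ true → u ≢ v → ∃ λ x → adj graph x y ≡ true
    below (inj₁ x)  refl u≤v _   = x , u≤v
    below (inj₂ y') refl u≤v u≢v = ⊥-elim (u≢v (height1-maximal Q (right-holds y') u≤v))

  ⊑-agrees : ∀ s t → s ⊑[ adj graph ] t ≡ le Q (to enum s) (to enum t)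
  ⊑-agrees (inj₁ x) (inj₁ x') with x ≟ x'
  ... | yes refl = sym (BipPoset.refl Q _)
  ... | no x≢x' = sym (¬-not {y = true} λ x≤x' →
    x≢x' (inj₁-injective (to-injective enum (height0-minimal Q (left-fails x') x≤x'))))
  ⊑-agrees (inj₁ x) (inj₂ y) = refl
  ⊑-agrees (inj₂ y) (inj₁ x) = sym (¬-not {y = true} λ y≤x →
    inj₁≢inj₂ (sym (to-injective enum (height0-minimal Q (left-fails x) y≤x))))
  ⊑-agrees (inj₂ y) (inj₂ y') with y ≟ y'
  ... | yes refl = sym (BipPoset.refl Q _)
  ... | no y≢y' = sym (¬-not {y = true} λ y≤y' →
    y≢y' (inj₂-injective (to-injective enum (height1-maximal Q (right-holds y) y≤y'))))

graphPoset-surjective : (Q : BipPoset n) → ∃ λ G → graphPoset G ≅P Q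
graphPoset-surjective Q =
  (graph , noIsolates) , ↔-trans (↔-sym (enumG graph)) enum , λ u v → ⊑-agrees _ _
  where open PosetGraph Q

theorem5p3 : (n : ℕ) →
    Σ (XYGraphNI n → BipPoset n) λ f →
      (∀ G H → G ≅GNI H → f G ≅P f H)
      × (∀ G H → f G ≅P f H → G ≅GNI H)
      × (∀ P → ∃ λ G → f G ≅P P)
      × (∀ G → UnbalancedG G → UnbalancedP (f G))
      × (∀ G → BalancedG G → BalancedP (f G))
theorem5p3 n =
  graphPoset , graphPoset-cong , graphPoset-reflects , graphPoset-surjective ,
  graphPoset-unbalanced , graphPoset-balanced
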